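{- Let $k\ge1$, let $s,t$ be syntax trees on $\mathcal{O}_k$ of arities $m$ and $n$, let $i\in[m]$, and let $\sigma=\mathrm{TEval}(s)\in\mathrm{Perm}_k(m)$ and $\tau=\mathrm{TEval}(t)\in\mathrm{Perm}_k(n)$. Write $\sigma=w_0\,i\,w_1\,i\,w_2\cdots w_{k-1}\,i\,w_k$ (the displayed $i$'s being the $k$ occurrences of the letter $i$), and write $w_k=\mu\nu$ where every letter of $\mu$ is smaller than $i$ and every letter of $\nu$ is larger than $i$ (such a factorization exists). Write $\tau=\tau_1\tau_2\cdots\tau_k\,\theta$ with $\tau_1,\dots,\tau_k$ letters. Then $$\mathrm{TEval}(s\circ_i t)=w_0[i,n]\,\tau_1[i-1]\,w_1[i,n]\,\tau_2[i-1]\,w_2[i,n]\cdots w_{k-1}[i,n]\,\tau_k[i-1]\,\mu\,\theta[i-1]\,\nu[i,n],$$ where $\mu$ is unchanged (its letters are $<i$) and $\nu[i,n]=\nu[n-1]$.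
   Context: $\mathcal{O}_k=\{\prec,\succ\}^k$. A $k$-permutation of degree $n$ is a word on $\{1^k,\dots,n^k\}$; $\mathrm{Perm}_k(n)$ is their set. For a word $w$ and integer $j$, $w[j]$ adds $j$ to each letter. For a word $w$ not containing the letter $i$, $w[i,n]$ keeps letters $x<i$ unchanged and replaces each letter $x>i$ by $x+n-1$. For $\omega\in\{\prec,\succ\}^*$ and words $X,Y$ with $|\omega|\le\min(|X|,|Y|)$: $X\,\varepsilon\,Y=XY$; $X\,(\prec\omega')\,Y=x(X'\,\omega'\,Y)$ if $X=xX'$; $X\,(\succ\omega')\,Y=y(X\,\omega'\,Y')$ if $Y=yY'$. For $\omega\in\mathcal{O}_k$, $\mu'\in\mathrm{Perm}_k(m)$, $\nu'\in\mathrm{Perm}_k(n)$ set $\mu'\,\omega\,\nu':=\mu'\,\omega\,\nu'[m]$. Syntax trees on $\mathcal{O}_k$: planar binary trees with internal nodes labeled by $\mathcal{O}_k$; $s\circ_i t$ grafts the root of $t$ on the $i$-th leaf (from the left) of $s$. The tidy series permutation evaluation $\mathrm{TEval}$ is defined recursively: a leaf evaluates to $1^k$, and a tree with root $\omega$, left subtree $l$, right subtree $r$ evaluates to $\mathrm{TEval}(l)\,\omega\,\mathrm{TEval}(r)$. -}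

module Defs where

open import Data.Nat using (ℕ; zero; suc; _+_; _*_; _∸_; _<ᵇ_)
open import Data.Bool using (if_then_else_)
open import Data.List using (List; []; _∷_; _++_; map; replicate; concat)
open import Data.Vec using (Vec; []; _∷_; zipWith; toList)

data Dir : Set where
  ≺ ≻ : Dir

Op : ℕ → Set
Op k = Vec Dir k

-- Words (k-permutations are words over positive integers)
Word : Set
Word = List ℕ

shift : ℕ → Word → Word
shift j w = map (λ x → x + j) w

-- w[i,n] : letters < i unchanged, letters x > i replaced by x + n - 1
-- (only applied to words not containing i)
expand : ℕ → ℕ → Word → Word
expand i n w = map (λ x → if x <ᵇ i then x else x + n ∸ 1) w

-- X ω Y for ω ∈ {≺,≻}^*  (words too short: irrelevant branch, never used
-- under the standing hypothesis |ω| ≤ min(|X|,|Y|))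
opW : ∀ {l} → Vec Dir l → Word → Word → Word
opW [] X Y = X ++ Y
opW (≺ ∷ ω) (x ∷ X) Y = x ∷ opW ω X Y
opW (≺ ∷ ω) [] Y = Y
opW (≻ ∷ ω) X (y ∷ Y) = y ∷ opW ω X Y
opW (≻ ∷ ω) X [] = X

data Tree (k : ℕ) : Set where
  leaf : Tree k
  node : Op k → Tree k → Tree k → Tree k

arity : ∀ {k} → Tree k → ℕ
arity leaf = 1
arity (node _ l r) = arity l + arity r

-- s ∘_i t : graft root of t on the i-th leaf (1-indexed, from the left) of s
graft : ∀ {k} → Tree k → ℕ → Tree k → Tree k
graft leaf zero t = leaf           -- out of range, irrelevant
graft leaf (suc zero) t = t
graft leaf (suc (suc i)) t = leaf  -- out of range, irrelevant
graft (node ω l r) i t =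
  if arity l <ᵇ i
  then node ω l (graft r (i ∸ arity l) t)
  else node ω (graft l i t) r

-- μ' ω ν' := μ' ω ν'[m] for μ' of degree m
-- Tidy series permutation evaluation
TEval : ∀ {k} → Tree k → Word
TEval {k} leaf = replicate k 1
TEval (node ω l r) = opW ω (TEval l) (shift (arity l) (TEval r))

module Submission where

-- Grafting t at leaf i of s acts on the word TEval s by a substitution: the k copies of i become
-- the first k letters of TEval t, the other letters are renumbered, and the rest of TEval t is
-- inserted after the last i.  This substitution commutes with each tidy product ω, because ω has
-- exactly k symbols while each subtree word contains k copies of each of its letters, so the
-- interleaving never reaches past the last i.  The same count shows that the suffix after the
-- last i splits as μν.

open import Defs
open import Data.Bool using (true; false; if_then_else_)
open import Data.Empty using (⊥-elim)
open import Data.Nat using (ℕ; zero; suc; _+_; _∸_; _≤_; _<_; _<ᵇ_; _≡ᵇ_; s≤s; s≤s⁻¹)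
open import Data.Nat.Properties
open import Algebra.Properties.CommutativeSemigroup +-commutativeSemigroup using (xy∙z≈xz∙y)
open import Data.List using ([]; _∷_; _++_; concat; replicate)
open import Data.List.Properties
  using (++-assoc; ++-identityʳ; map-++; map-∘; map-cong; map-id; ∷-injectiveʳ)
open import Data.List.Relation.Unary.All as All using (All; []; _∷_)
import Data.List.Relation.Unary.All.Properties as AllP
open import Data.List.Relation.Unary.Any using (here; there)
open import Data.List.Membership.Propositional using (_∈_; _∉_)
open import Data.List.Membership.Propositional.Properties using (∈-++⁺ʳ)
open import Data.Vec using (Vec; []; _∷_; zipWith; toList) renaming (map to vmap)
import Data.Vec.Properties as VecP
open import Data.Product using (∃; ∃₂; _×_; _,_)
open import Function using (_∘_)
open import Relation.Nullary using (yes; no)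
open import Relation.Nullary.Decidable using (dec-true; dec-false)
open import Relation.Binary.PropositionalEquality
open ≡-Reasoning

<ᵇ-true : ∀ {x y} → x < y → (x <ᵇ y) ≡ true
<ᵇ-true {x} {y} = dec-true (x <? y)

<ᵇ-false : ∀ {x y} → y ≤ x → (x <ᵇ y) ≡ false
<ᵇ-false {x} {y} y≤x = dec-false (x <? y) (≤⇒≯ y≤x)

≡ᵇ-refl : ∀ x → (x ≡ᵇ x) ≡ true
≡ᵇ-refl x = dec-true (x ≟ x) refl

≡ᵇ-false : ∀ {x y} → x ≢ y → (x ≡ᵇ y) ≡ false
≡ᵇ-false {x} {y} = dec-false (x ≟ y)

<ᵇ-+ʳ : ∀ x y a → (x + a <ᵇ y + a) ≡ (x <ᵇ y)
<ᵇ-+ʳ x y a rewrite +-comm x a | +-comm y a = go a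
  where
  go : ∀ a → (a + x <ᵇ a + y) ≡ (x <ᵇ y)
  go zero = refl
  go (suc a) = go a

≡ᵇ-+ʳ : ∀ x y a → (x + a ≡ᵇ y + a) ≡ (x ≡ᵇ y)
≡ᵇ-+ʳ x y a rewrite +-comm x a | +-comm y a = go a
  where
  go : ∀ a → (a + x ≡ᵇ a + y) ≡ (x ≡ᵇ y)
  go zero = refl
  go (suc a) = go a

+-∸1-right-comm : ∀ x {n} a → 1 ≤ n → x + n ∸ 1 + a ≡ x + a + n ∸ 1
+-∸1-right-comm x {n} a 1≤n = begin
  x + n ∸ 1 + a  ≡⟨ sym (+-∸-comm a (≤-trans 1≤n (m≤n+m n x))) ⟩
  x + n + a ∸ 1  ≡⟨ cong (_∸ 1) (xy∙z≈xz∙y x n a) ⟩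
  x + a + n ∸ 1  ∎

∸-∸1-+ : ∀ {a i} → a < i → i ∸ a ∸ 1 + a ≡ i ∸ 1
∸-∸1-+ {a} {suc p} (s≤s a≤p) = begin
  suc p ∸ a ∸ 1 + a  ≡⟨ cong (λ x → x ∸ 1 + a) (+-∸-assoc 1 a≤p) ⟩
  p ∸ a + a          ≡⟨ m∸n+n≡m a≤p ⟩
  p                  ∎

expandLetter : ℕ → ℕ → ℕ → ℕ
expandLetter i n x = if x <ᵇ i then x else x + n ∸ 1

expandLetter-< : ∀ {i n x} → x < i → expandLetter i n x ≡ x
expandLetter-< x<i rewrite <ᵇ-true x<i = refl

expandLetter-≥ : ∀ {i n x} → i ≤ x → expandLetter i n x ≡ x + n ∸ 1
expandLetter-≥ i≤x rewrite <ᵇ-false i≤x = refl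

expandLetter-+ : ∀ i n a x → 1 ≤ n → expandLetter i n x + a ≡ expandLetter (i + a) n (x + a)
expandLetter-+ i n a x 1≤n rewrite <ᵇ-+ʳ x i a with x <ᵇ i
... | true = refl
... | false = +-∸1-right-comm x a 1≤n

shift-expand : ∀ i n a w → 1 ≤ n → shift a (expand i n w) ≡ expand (i + a) n (shift a w)
shift-expand i n a [] _ = refl
shift-expand i n a (x ∷ w) 1≤n =
  cong₂ _∷_ (expandLetter-+ i n a x 1≤n) (shift-expand i n a w 1≤n)

expand-shift-above : ∀ i n a w → i ≤ a → 1 ≤ n →
  expand i n (shift a w) ≡ shift (a + n ∸ 1) w
expand-shift-above i n a [] _ _ = refl
expand-shift-above i n a (x ∷ w) i≤a 1≤n =
  cong₂ _∷_ head (expand-shift-above i n a w i≤a 1≤n)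
  where
  head : expandLetter i n (x + a) ≡ x + (a + n ∸ 1)
  head = begin
    expandLetter i n (x + a)  ≡⟨ expandLetter-≥ (≤-trans i≤a (m≤n+m a x)) ⟩
    x + a + n ∸ 1             ≡⟨ cong (_∸ 1) (+-assoc x a n) ⟩
    x + (a + n) ∸ 1           ≡⟨ +-∸-assoc x (≤-trans 1≤n (m≤n+m n a)) ⟩
    x + (a + n ∸ 1)           ∎

shift-zero : ∀ w → shift 0 w ≡ w
shift-zero w = trans (map-cong +-identityʳ w) (map-id w)

shift-shift : ∀ a b w → shift a (shift b w) ≡ shift (b + a) w
shift-shift a b w = trans (sym (map-∘ w)) (map-cong (λ x → +-assoc x b a) w)

shift-above : ∀ {j a w} → j ≤ a → All (1 ≤_) w → All (j <_) (shift a w)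
shift-above {a = a} j≤a = AllP.map⁺ ∘ All.map (λ 1≤x → ≤-trans (s≤s j≤a) (+-monoˡ-≤ a 1≤x))

mult : ℕ → Word → ℕ
mult j [] = 0
mult j (x ∷ w) = if x ≡ᵇ j then suc (mult j w) else mult j w

≤-mult-tail : ∀ {l} j x w → suc l ≤ mult j (x ∷ w) → l ≤ mult j w
≤-mult-tail j x w with x ≡ᵇ j
... | true = s≤s⁻¹
... | false = <⇒≤

mult-++ : ∀ j X Y → mult j (X ++ Y) ≡ mult j X + mult j Y
mult-++ j [] Y = refl
mult-++ j (x ∷ X) Y with x ≡ᵇ j
... | true = cong suc (mult-++ j X Y)
... | false = mult-++ j X Y

mult-opW : ∀ j {l} (ω : Vec Dir l) X Y → mult j (opW ω X Y) ≡ mult j X + mult j Y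
mult-opW j [] X Y = mult-++ j X Y
mult-opW j (≺ ∷ ω) [] Y = refl
mult-opW j (≺ ∷ ω) (x ∷ X) Y with x ≡ᵇ j
... | true = cong suc (mult-opW j ω X Y)
... | false = mult-opW j ω X Y
mult-opW j (≻ ∷ ω) X [] = sym (+-identityʳ _)
mult-opW j (≻ ∷ ω) X (y ∷ Y) with y ≡ᵇ j
... | true = trans (cong suc (mult-opW j ω X Y)) (sym (+-suc _ _))
... | false = mult-opW j ω X Y

mult-shift : ∀ j a w → a ≤ j → mult j (shift a w) ≡ mult (j ∸ a) w
mult-shift j a w a≤j =
  subst (λ j′ → mult j′ (shift a w) ≡ mult (j ∸ a) w) (m∸n+n≡m a≤j) (go w)
  where
  go : ∀ w → mult (j ∸ a + a) (shift a w) ≡ mult (j ∸ a) w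
  go [] = refl
  go (x ∷ w) rewrite ≡ᵇ-+ʳ x (j ∸ a) a with x ≡ᵇ j ∸ a
  ... | true = cong suc (go w)
  ... | false = go w

mult-replicate : ∀ k j → mult j (replicate k j) ≡ k
mult-replicate zero j = refl
mult-replicate (suc k) j rewrite ≡ᵇ-refl j = cong suc (mult-replicate k j)

mult-absent : ∀ j w → All (_≢ j) w → mult j w ≡ 0
mult-absent j [] [] = refl
mult-absent j (x ∷ w) (x≢j ∷ w≢j) rewrite ≡ᵇ-false x≢j = mult-absent j w w≢j

All-opW : ∀ {P : ℕ → Set} {l} (ω : Vec Dir l) {X Y} →
  All P X → All P Y → All P (opW ω X Y)
All-opW [] PX PY = AllP.++⁺ PX PY
All-opW (≺ ∷ ω) [] PY = PY
All-opW (≺ ∷ ω) (Px ∷ PX) PY = Px ∷ All-opW ω PX PY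
All-opW (≻ ∷ ω) PX [] = PX
All-opW (≻ ∷ ω) PX (Py ∷ PY) = Py ∷ All-opW ω PX PY

arity-positive : ∀ {k} (s : Tree k) → 1 ≤ arity s
arity-positive leaf = ≤-refl
arity-positive (node ω l r) = ≤-trans (arity-positive l) (m≤m+n _ _)

data LeafIn {k} (l r : Tree k) (j : ℕ) : Set where
  leafˡ : 1 ≤ j → j ≤ arity l → LeafIn l r j
  leafʳ : arity l < j → 1 ≤ j ∸ arity l → j ∸ arity l ≤ arity r → LeafIn l r j

locateLeaf : ∀ {k} (l r : Tree k) {j} → 1 ≤ j → j ≤ arity l + arity r → LeafIn l r j
locateLeaf l r {j} 1≤j j≤l+r with j ≤? arity l
... | yes j≤l = leafˡ 1≤j j≤l
... | no j≰l = leafʳ l<j (m<n⇒0<n∸m l<j) (m≤n+o⇒m∸n≤o j (arity l) j≤l+r)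
  where
  l<j : arity l < j
  l<j = ≰⇒> j≰l

graft-left : ∀ {k} (ω : Op k) l r t {i} → i ≤ arity l →
  graft (node ω l r) i t ≡ node ω (graft l i t) r
graft-left ω l r t i≤l rewrite <ᵇ-false i≤l = refl

graft-right : ∀ {k} (ω : Op k) l r t {i} → arity l < i →
  graft (node ω l r) i t ≡ node ω l (graft r (i ∸ arity l) t)
graft-right ω l r t l<i rewrite <ᵇ-true l<i = refl

arity-graft : ∀ {k} (s t : Tree k) {i} → 1 ≤ i → i ≤ arity s →
  arity (graft s i t) ≡ arity s + arity t ∸ 1
arity-graft leaf t {suc zero} _ _ = refl
arity-graft leaf t {suc (suc _)} _ (s≤s ())
arity-graft (node ω l r) t {i} 1≤i i≤s with locateLeaf l r 1≤i i≤s
... | leafˡ _ i≤l = begin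
  arity (graft (node ω l r) i t)   ≡⟨ cong arity (graft-left ω l r t i≤l) ⟩
  arity (graft l i t) + arity r    ≡⟨ cong (_+ arity r) (arity-graft l t 1≤i i≤l) ⟩
  arity l + arity t ∸ 1 + arity r  ≡⟨ +-∸1-right-comm (arity l) (arity r) (arity-positive t) ⟩
  arity l + arity r + arity t ∸ 1  ∎
... | leafʳ l<i 1≤i′ i′≤r = begin
  arity (graft (node ω l r) i t)             ≡⟨ cong arity (graft-right ω l r t l<i) ⟩
  arity l + arity (graft r (i ∸ arity l) t)  ≡⟨ cong (arity l +_) (arity-graft r t 1≤i′ i′≤r) ⟩
  arity l + (arity r + arity t ∸ 1)          ≡⟨ sym (+-∸-assoc (arity l) 1≤r+t) ⟩
  arity l + (arity r + arity t) ∸ 1          ≡⟨ cong (_∸ 1) (sym (+-assoc (arity l) (arity r) _)) ⟩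
  arity l + arity r + arity t ∸ 1            ∎
  where
  1≤r+t : 1 ≤ arity r + arity t
  1≤r+t = ≤-trans (arity-positive t) (m≤n+m _ _)

TEval-positive : ∀ {k} (s : Tree k) → All (1 ≤_) (TEval s)
TEval-positive {k} leaf = AllP.replicate⁺ k ≤-refl
TEval-positive (node ω l r) =
  All-opW ω (TEval-positive l)
    (AllP.map⁺ (All.map (λ {x} 1≤x → ≤-trans 1≤x (m≤m+n x _)) (TEval-positive r)))

TEval-bounded : ∀ {k} (s : Tree k) → All (_≤ arity s) (TEval s)
TEval-bounded {k} leaf = AllP.replicate⁺ k ≤-refl
TEval-bounded (node ω l r) =
  All-opW ω (All.map (λ x≤l → ≤-trans x≤l (m≤m+n _ _)) (TEval-bounded l))
    (AllP.map⁺ (All.map shifted-bound (TEval-bounded r)))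
  where
  shifted-bound : ∀ {x} → x ≤ arity r → x + arity l ≤ arity l + arity r
  shifted-bound x≤r = ≤-trans (+-monoˡ-≤ (arity l) x≤r) (≤-reflexive (+-comm (arity r) (arity l)))

shift-TEval-above : ∀ {k} (s : Tree k) {a j} → j ≤ a → All (j <_) (shift a (TEval s))
shift-TEval-above s j≤a = shift-above j≤a (TEval-positive s)

TEval-below : ∀ {k} (s : Tree k) {j} → arity s < j → All (_< j) (TEval s)
TEval-below s s<j = All.map (λ x≤s → ≤-<-trans x≤s s<j) (TEval-bounded s)

TEval-mult : ∀ {k} (s : Tree k) {j} → 1 ≤ j → j ≤ arity s → mult j (TEval s) ≡ k
TEval-mult {k} leaf {suc zero} _ _ = mult-replicate k 1
TEval-mult leaf {suc (suc _)} _ (s≤s ())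
TEval-mult {k} (node ω l r) {j} 1≤j j≤s with locateLeaf l r 1≤j j≤s
... | leafˡ _ j≤l = begin
  mult j (opW ω L R′)       ≡⟨ mult-opW j ω L R′ ⟩
  mult j L + mult j R′      ≡⟨ cong₂ _+_ (TEval-mult l 1≤j j≤l) R′-absent ⟩
  k + 0                     ≡⟨ +-identityʳ k ⟩
  k                         ∎
  where
  L R′ : Word
  L = TEval l
  R′ = shift (arity l) (TEval r)
  R′-absent : mult j R′ ≡ 0
  R′-absent = mult-absent j R′ (All.map >⇒≢ (shift-TEval-above r j≤l))
... | leafʳ l<j 1≤j′ j′≤r = begin
  mult j (opW ω L R′)       ≡⟨ mult-opW j ω L R′ ⟩
  mult j L + mult j R′      ≡⟨ cong (_+ mult j R′) L-absent ⟩
  mult j R′                 ≡⟨ mult-shift j (arity l) (TEval r) (<⇒≤ l<j) ⟩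
  mult (j ∸ arity l) (TEval r) ≡⟨ TEval-mult r 1≤j′ j′≤r ⟩
  k                         ∎
  where
  L R′ : Word
  L = TEval l
  R′ = shift (arity l) (TEval r)
  L-absent : mult j L ≡ 0
  L-absent = mult-absent j L (All.map <⇒≢ (TEval-below l l<j))

SplitsAt : ℕ → Word → Set
SplitsAt j w = ∃₂ λ μ ν → w ≡ μ ++ ν × All (_< j) μ × All (j <_) ν

SplitsAt-avoids : ∀ {j w} → SplitsAt j w → All (_≢ j) w
SplitsAt-avoids (μ , ν , refl , μ<j , j<ν) = AllP.++⁺ (All.map <⇒≢ μ<j) (All.map >⇒≢ j<ν)

SplitsAt-++ˡ : ∀ {j X w} → All (_< j) X → SplitsAt j w → SplitsAt j (X ++ w)
SplitsAt-++ˡ {X = X} X<j (μ , ν , refl , μ<j , j<ν) =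
  X ++ μ , ν , sym (++-assoc X μ ν) , AllP.++⁺ X<j μ<j , j<ν

SplitsAt-++ʳ : ∀ {j w Y} → SplitsAt j w → All (j <_) Y → SplitsAt j (w ++ Y)
SplitsAt-++ʳ {Y = Y} (μ , ν , refl , μ<j , j<ν) j<Y =
  μ , ν ++ Y , ++-assoc μ ν Y , μ<j , AllP.++⁺ j<ν j<Y

SplitsAt-shift : ∀ {j w} a → SplitsAt j w → SplitsAt (j + a) (shift a w)
SplitsAt-shift a (μ , ν , refl , μ<j , j<ν) =
  shift a μ , shift a ν , map-++ _ μ ν ,
  AllP.map⁺ (All.map (+-monoˡ-< a) μ<j) , AllP.map⁺ (All.map (+-monoˡ-< a) j<ν)

-- B follows the last j of w, since B contains no j.
TidyAt : ℕ → Word → Set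
TidyAt j w = ∃₂ λ A B → w ≡ A ++ j ∷ B × SplitsAt j B

TidyAt-∷ : ∀ {j w} x → TidyAt j w → TidyAt j (x ∷ w)
TidyAt-∷ x (A , B , refl , B-splits) = x ∷ A , B , refl , B-splits

TidyAt-shift : ∀ {j w} a → TidyAt j w → TidyAt (j + a) (shift a w)
TidyAt-shift a (A , B , refl , B-splits) =
  shift a A , shift a B , map-++ _ A (_ ∷ B) , SplitsAt-shift a B-splits

TidyAt-replicate : ∀ k j → TidyAt j (replicate (suc k) j)
TidyAt-replicate zero j = [] , [] , refl , [] , [] , refl , [] , []
TidyAt-replicate (suc k) j = TidyAt-∷ j (TidyAt-replicate k j)

mult-last : ∀ {j} B → SplitsAt j B → mult j (j ∷ B) ≡ 1
mult-last {j} B B-splits rewrite ≡ᵇ-refl j = cong suc (mult-absent j B (SplitsAt-avoids B-splits))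

-- Since l ≤ mult j X, the interleaving stops at the latest on the last j of X.
TidyAt-opWˡ : ∀ {j l} (ω : Vec Dir l) {X Y} →
  TidyAt j X → l ≤ mult j X → All (j <_) Y → TidyAt j (opW ω X Y)
TidyAt-opWˡ [] {Y = Y} (A , B , refl , B-splits) _ j<Y =
  A , B ++ Y , ++-assoc A (_ ∷ B) Y , SplitsAt-++ʳ B-splits j<Y
TidyAt-opWˡ (≺ ∷ []) {Y = Y} ([] , B , refl , B-splits) _ j<Y =
  [] , B ++ Y , refl , SplitsAt-++ʳ B-splits j<Y
TidyAt-opWˡ (≺ ∷ _ ∷ _) ([] , B , refl , B-splits) l≤ _ =
  ⊥-elim (n≮0 (s≤s⁻¹ (≤-trans l≤ (≤-reflexive (mult-last B B-splits)))))
TidyAt-opWˡ (≺ ∷ ω) (a ∷ A , B , refl , B-splits) l≤ j<Y =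
  TidyAt-∷ a (TidyAt-opWˡ ω (A , B , refl , B-splits) (≤-mult-tail _ a (A ++ _ ∷ B) l≤) j<Y)
TidyAt-opWˡ (≻ ∷ ω) {Y = []} X-tidy _ _ = X-tidy
TidyAt-opWˡ (≻ ∷ ω) {Y = y ∷ Y} X-tidy l≤ (_ ∷ j<Y) =
  TidyAt-∷ y (TidyAt-opWˡ ω X-tidy (<⇒≤ l≤) j<Y)

TidyAt-opWʳ : ∀ {j l} (ω : Vec Dir l) {X Y} →
  All (_< j) X → TidyAt j Y → l ≤ mult j Y → TidyAt j (opW ω X Y)
TidyAt-opWʳ [] {X = X} _ (A , B , refl , B-splits) _ =
  X ++ A , B , sym (++-assoc X A (_ ∷ B)) , B-splits
TidyAt-opWʳ (≺ ∷ ω) [] Y-tidy _ = Y-tidy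
TidyAt-opWʳ (≺ ∷ ω) {x ∷ X} (_ ∷ X<j) Y-tidy l≤ =
  TidyAt-∷ x (TidyAt-opWʳ ω X<j Y-tidy (<⇒≤ l≤))
TidyAt-opWʳ (≻ ∷ []) {X = X} X<j ([] , B , refl , B-splits) _ =
  [] , X ++ B , refl , SplitsAt-++ˡ X<j B-splits
TidyAt-opWʳ (≻ ∷ _ ∷ _) _ ([] , B , refl , B-splits) l≤ =
  ⊥-elim (n≮0 (s≤s⁻¹ (≤-trans l≤ (≤-reflexive (mult-last B B-splits)))))
TidyAt-opWʳ (≻ ∷ ω) X<j (a ∷ A , B , refl , B-splits) l≤ =
  TidyAt-∷ a (TidyAt-opWʳ ω X<j (A , B , refl , B-splits) (≤-mult-tail _ a (A ++ _ ∷ B) l≤))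

TEval-tidy : ∀ {k} → 1 ≤ k → (s : Tree k) → ∀ {j} → 1 ≤ j → j ≤ arity s → TidyAt j (TEval s)
TEval-tidy {suc k} _ leaf {suc zero} _ _ = TidyAt-replicate k 1
TEval-tidy _ leaf {suc (suc _)} _ (s≤s ())
TEval-tidy {k} k≥1 (node ω l r) {j} 1≤j j≤s with locateLeaf l r 1≤j j≤s
... | leafˡ _ j≤l =
  TidyAt-opWˡ ω (TEval-tidy k≥1 l 1≤j j≤l) (≤-reflexive (sym (TEval-mult l 1≤j j≤l)))
    (shift-TEval-above r j≤l)
... | leafʳ l<j 1≤j′ j′≤r =
  TidyAt-opWʳ ω (TEval-below l l<j) R′-tidy (≤-reflexive (sym R′-mult))
  where
  R′-tidy : TidyAt j (shift (arity l) (TEval r))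
  R′-tidy = subst (λ j′ → TidyAt j′ _) (m∸n+n≡m (<⇒≤ l<j))
                  (TidyAt-shift (arity l) (TEval-tidy k≥1 r 1≤j′ j′≤r))
  R′-mult : mult j (shift (arity l) (TEval r)) ≡ k
  R′-mult = trans (mult-shift j (arity l) (TEval r) (<⇒≤ l<j)) (TEval-mult r 1≤j′ j′≤r)

last-suffix-unique : ∀ {j : ℕ} C A {V B} → C ++ j ∷ V ≡ A ++ j ∷ B → j ∉ V → j ∉ B → V ≡ B
last-suffix-unique [] [] eq _ _ = ∷-injectiveʳ eq
last-suffix-unique [] (a ∷ A) eq j∉V _ =
  ⊥-elim (j∉V (subst (_ ∈_) (sym (∷-injectiveʳ eq)) (∈-++⁺ʳ A (here refl))))
last-suffix-unique (c ∷ C) [] eq _ j∉B =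
  ⊥-elim (j∉B (subst (_ ∈_) (∷-injectiveʳ eq) (∈-++⁺ʳ C (here refl))))
last-suffix-unique (c ∷ C) (a ∷ A) eq j∉V j∉B = last-suffix-unique C A (∷-injectiveʳ eq) j∉V j∉B

TidyAt-suffix : ∀ {j} C {V} → TidyAt j (C ++ j ∷ V) → j ∉ V → SplitsAt j V
TidyAt-suffix C (A , B , eq , B-splits) j∉V =
  subst (SplitsAt _) (sym (last-suffix-unique C A eq j∉V j∉B)) B-splits
  where
  j∉B : _ ∉ B
  j∉B j∈B = All.lookup (SplitsAt-avoids B-splits) j∈B refl

concat-∷ʳ : ∀ (i : ℕ) {k} (ws : Vec Word (suc k)) →
  ∃ λ C → concat (toList (vmap (λ w → w ++ i ∷ []) ws)) ≡ C ++ i ∷ []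
concat-∷ʳ i (w ∷ []) = w , ++-identityʳ (w ++ i ∷ [])
concat-∷ʳ i (w ∷ w′ ∷ ws) with concat-∷ʳ i (w′ ∷ ws)
... | C , eq = (w ++ i ∷ []) ++ C ,
               trans (cong ((w ++ i ∷ []) ++_) eq) (sym (++-assoc (w ++ i ∷ []) C (i ∷ [])))

splice : ℕ → ℕ → Word → Word → Word
splice i n θ [] = θ
splice i n θ (x ∷ w) = if x <ᵇ i then x ∷ splice i n θ w else θ ++ expand i n (x ∷ w)

-- The image of w under grafting n leaves at leaf i: the successive occurrences of i become the
-- letters of τs, every other letter x becomes x[i,n], and θ is spliced in after the last i.
graftWord : ∀ {m} → ℕ → ℕ → Vec ℕ m → Word → Word → Word
graftWord i n [] θ w = splice i n θ w
graftWord i n (τ ∷ τs) θ [] = []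
graftWord i n (τ ∷ τs) θ (x ∷ w) =
  if x ≡ᵇ i then τ ∷ graftWord i n τs θ w else expandLetter i n x ∷ graftWord i n (τ ∷ τs) θ w

splice-++ : ∀ i n θ X {Y} → All (i <_) Y → splice i n θ (X ++ Y) ≡ splice i n θ X ++ expand i n Y
splice-++ i n θ [] {[]} [] = sym (++-identityʳ θ)
splice-++ i n θ [] {y ∷ Y} (i<y ∷ _) rewrite <ᵇ-false (<⇒≤ i<y) = refl
splice-++ i n θ (x ∷ X) {Y} i<Y with x <ᵇ i
... | true = cong (x ∷_) (splice-++ i n θ X i<Y)
... | false = trans (cong (λ z → θ ++ (x + n ∸ 1) ∷ z) (map-++ _ X Y)) (sym (++-assoc θ _ _))

splice-shift : ∀ i n a θ w → 1 ≤ n →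
  shift a (splice i n θ w) ≡ splice (i + a) n (shift a θ) (shift a w)
splice-shift i n a θ [] _ = refl
splice-shift i n a θ (x ∷ w) 1≤n rewrite <ᵇ-+ʳ x i a with x <ᵇ i
... | true = cong (x + a ∷_) (splice-shift i n a θ w 1≤n)
... | false = trans (map-++ _ θ _)
  (cong (shift a θ ++_) (cong₂ _∷_ (+-∸1-right-comm x a 1≤n) (shift-expand i n a w 1≤n)))

graftWord-++ˡ : ∀ i n {m} (τs : Vec ℕ m) θ X {Y} → mult i X ≡ m → All (i <_) Y →
  graftWord i n τs θ (X ++ Y) ≡ graftWord i n τs θ X ++ expand i n Y
graftWord-++ˡ i n [] θ X _ i<Y = splice-++ i n θ X i<Y
graftWord-++ˡ i n (τ ∷ τs) θ [] () _
graftWord-++ˡ i n (τ ∷ τs) θ (x ∷ X) X-mult i<Y with x ≡ᵇ i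
... | true = cong (τ ∷_) (graftWord-++ˡ i n τs θ X (suc-injective X-mult) i<Y)
... | false = cong (expandLetter i n x ∷_) (graftWord-++ˡ i n (τ ∷ τs) θ X X-mult i<Y)

graftWord-++ʳ : ∀ i n {m} (τs : Vec ℕ m) θ {X} Y → All (_< i) X →
  graftWord i n τs θ (X ++ Y) ≡ X ++ graftWord i n τs θ Y
graftWord-++ʳ i n τs θ Y [] = refl
graftWord-++ʳ i n [] θ Y (x<i ∷ X<i) rewrite <ᵇ-true x<i =
  cong (_ ∷_) (graftWord-++ʳ i n [] θ Y X<i)
graftWord-++ʳ i n (τ ∷ τs) θ Y (x<i ∷ X<i) rewrite ≡ᵇ-false (<⇒≢ x<i) =
  cong₂ _∷_ (expandLetter-< x<i) (graftWord-++ʳ i n (τ ∷ τs) θ Y X<i)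

graftWord-opWˡ : ∀ i n {l m} (ω : Vec Dir l) (τs : Vec ℕ m) θ X {Y} →
  mult i X ≡ m → l ≤ m → All (i <_) Y →
  graftWord i n τs θ (opW ω X Y) ≡ opW ω (graftWord i n τs θ X) (expand i n Y)
graftWord-opWˡ i n [] τs θ X X-mult _ i<Y = graftWord-++ˡ i n τs θ X X-mult i<Y
graftWord-opWˡ i n (_ ∷ _) [] θ X _ () _
graftWord-opWˡ i n (≺ ∷ ω) (τ ∷ τs) θ [] () _ _
graftWord-opWˡ i n (≺ ∷ ω) (τ ∷ τs) θ (x ∷ X) X-mult (s≤s l≤m) i<Y with x ≡ᵇ i
... | true = cong (τ ∷_) (graftWord-opWˡ i n ω τs θ X (suc-injective X-mult) l≤m i<Y)
... | false =
  cong (expandLetter i n x ∷_) (graftWord-opWˡ i n ω (τ ∷ τs) θ X X-mult (m≤n⇒m≤1+n l≤m) i<Y)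
graftWord-opWˡ i n (≻ ∷ ω) (τ ∷ τs) θ X {[]} _ _ [] = refl
graftWord-opWˡ i n (≻ ∷ ω) (τ ∷ τs) θ X {y ∷ Y} X-mult (s≤s l≤m) (i<y ∷ i<Y)
  rewrite ≡ᵇ-false (>⇒≢ i<y) =
  cong (expandLetter i n y ∷_) (graftWord-opWˡ i n ω (τ ∷ τs) θ X X-mult (m≤n⇒m≤1+n l≤m) i<Y)

graftWord-opWʳ : ∀ i n {l m} (ω : Vec Dir l) (τs : Vec ℕ m) θ {X} Y →
  All (_< i) X → mult i Y ≡ m → l ≤ m →
  graftWord i n τs θ (opW ω X Y) ≡ opW ω X (graftWord i n τs θ Y)
graftWord-opWʳ i n [] τs θ Y X<i _ _ = graftWord-++ʳ i n τs θ Y X<i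
graftWord-opWʳ i n (_ ∷ _) [] θ Y _ _ ()
graftWord-opWʳ i n (≺ ∷ ω) (τ ∷ τs) θ Y [] _ _ = refl
graftWord-opWʳ i n (≺ ∷ ω) (τ ∷ τs) θ Y (x<i ∷ X<i) Y-mult (s≤s l≤m)
  rewrite ≡ᵇ-false (<⇒≢ x<i) =
  cong₂ _∷_ (expandLetter-< x<i) (graftWord-opWʳ i n ω (τ ∷ τs) θ Y X<i Y-mult (m≤n⇒m≤1+n l≤m))
graftWord-opWʳ i n (≻ ∷ ω) (τ ∷ τs) θ [] _ () _
graftWord-opWʳ i n (≻ ∷ ω) (τ ∷ τs) θ (y ∷ Y) X<i Y-mult (s≤s l≤m) with y ≡ᵇ i
... | true = cong (τ ∷_) (graftWord-opWʳ i n ω τs θ Y X<i (suc-injective Y-mult) l≤m)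
... | false =
  cong (expandLetter i n y ∷_) (graftWord-opWʳ i n ω (τ ∷ τs) θ Y X<i Y-mult (m≤n⇒m≤1+n l≤m))

graftWord-shift : ∀ i n a {m} (τs : Vec ℕ m) θ w → 1 ≤ n →
  shift a (graftWord i n τs θ w) ≡ graftWord (i + a) n (vmap (_+ a) τs) (shift a θ) (shift a w)
graftWord-shift i n a [] θ w 1≤n = splice-shift i n a θ w 1≤n
graftWord-shift i n a (τ ∷ τs) θ [] _ = refl
graftWord-shift i n a (τ ∷ τs) θ (x ∷ w) 1≤n rewrite ≡ᵇ-+ʳ x i a with x ≡ᵇ i
... | true = cong (τ + a ∷_) (graftWord-shift i n a τs θ w 1≤n)
... | false = cong₂ _∷_ (expandLetter-+ i n a x 1≤n) (graftWord-shift i n a (τ ∷ τs) θ w 1≤n)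

graftWord-replicate : ∀ i n {k} (τs : Vec ℕ k) θ →
  graftWord i n τs θ (replicate k i) ≡ toList τs ++ θ
graftWord-replicate i n [] θ = refl
graftWord-replicate i n (τ ∷ τs) θ rewrite ≡ᵇ-refl i = cong (τ ∷_) (graftWord-replicate i n τs θ)

TEval-graft : ∀ {k} (s t : Tree k) {i} → 1 ≤ i → i ≤ arity s → (τs : Vec ℕ k) (θ : Word) →
  TEval t ≡ toList τs ++ θ →
  TEval (graft s i t) ≡ graftWord i (arity t) (vmap (_+ (i ∸ 1)) τs) (shift (i ∸ 1) θ) (TEval s)
TEval-graft {k} leaf t {suc zero} _ _ τs θ t≡ = begin
  TEval t                               ≡⟨ t≡ ⟩
  toList τs ++ θ
    ≡⟨ sym (cong₂ (λ σs ϑ → toList σs ++ ϑ) τs+0 (shift-zero θ)) ⟩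
  toList (vmap (_+ 0) τs) ++ shift 0 θ
    ≡⟨ sym (graftWord-replicate 1 (arity t) _ (shift 0 θ)) ⟩
  graftWord 1 (arity t) (vmap (_+ 0) τs) (shift 0 θ) (replicate k 1) ∎
  where
  τs+0 : vmap (_+ 0) τs ≡ τs
  τs+0 = trans (VecP.map-cong +-identityʳ τs) (VecP.map-id τs)
TEval-graft leaf t {suc (suc _)} _ (s≤s ()) τs θ t≡
TEval-graft {k} (node ω l r) t {i} 1≤i i≤s τs θ t≡ = node-case (locateLeaf l r 1≤i i≤s)
  where
  a n : ℕ
  a = arity l
  n = arity t
  L R : Word
  L = TEval l
  R = TEval r
  τs′ : Vec ℕ k
  τs′ = vmap (_+ (i ∸ 1)) τs
  θ′ : Word
  θ′ = shift (i ∸ 1) θ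
  G : Word → Word
  G = graftWord i n τs′ θ′

  node-case : LeafIn l r i → TEval (graft (node ω l r) i t) ≡ G (opW ω L (shift a R))
  node-case (leafˡ _ i≤a) = begin
    TEval (graft (node ω l r) i t)                              ≡⟨ cong TEval (graft-left ω l r t i≤a) ⟩
    opW ω (TEval (graft l i t)) (shift (arity (graft l i t)) R) ≡⟨ cong₂ (opW ω) left-IH right-expanded ⟩
    opW ω (G L) (expand i n (shift a R))                        ≡⟨ sym (graftWord-opWˡ i n ω τs′ θ′ L
                                                                         L-mult ≤-refl i<R) ⟩
    G (opW ω L (shift a R))                                     ∎
    where
    left-IH : TEval (graft l i t) ≡ G L
    left-IH = TEval-graft l t 1≤i i≤a τs θ t≡
    L-mult : mult i L ≡ k
    L-mult = TEval-mult l 1≤i i≤a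
    i<R : All (i <_) (shift a R)
    i<R = shift-TEval-above r i≤a
    right-expanded : shift (arity (graft l i t)) R ≡ expand i n (shift a R)
    right-expanded = begin
      shift (arity (graft l i t)) R  ≡⟨ cong (λ b → shift b R) (arity-graft l t 1≤i i≤a) ⟩
      shift (a + n ∸ 1) R            ≡⟨ sym (expand-shift-above i n a R i≤a (arity-positive t)) ⟩
      expand i n (shift a R)         ∎
  node-case (leafʳ a<i 1≤i′ i′≤r) = begin
    TEval (graft (node ω l r) i t)                 ≡⟨ cong TEval (graft-right ω l r t a<i) ⟩
    opW ω L (shift a (TEval (graft r (i ∸ a) t)))  ≡⟨ cong (opW ω L ∘ shift a) right-IH ⟩
    opW ω L (shift a (G′ R))                       ≡⟨ cong (opW ω L) (shift-G′ R) ⟩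
    opW ω L (G (shift a R))                        ≡⟨ sym (graftWord-opWʳ i n ω τs′ θ′ (shift a R)
                                                            (TEval-below l a<i) R-mult ≤-refl) ⟩
    G (opW ω L (shift a R))                        ∎
    where
    c : ℕ
    c = i ∸ a ∸ 1
    G′ : Word → Word
    G′ = graftWord (i ∸ a) n (vmap (_+ c) τs) (shift c θ)
    right-IH : TEval (graft r (i ∸ a) t) ≡ G′ R
    right-IH = TEval-graft r t 1≤i′ i′≤r τs θ t≡
    R-mult : mult i (shift a R) ≡ k
    R-mult = trans (mult-shift i a R (<⇒≤ a<i)) (TEval-mult r 1≤i′ i′≤r)
    c+a : c + a ≡ i ∸ 1
    c+a = ∸-∸1-+ a<i
    τs-reindexed : vmap (_+ a) (vmap (_+ c) τs) ≡ τs′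
    τs-reindexed =
      trans (sym (VecP.map-∘ _ _ τs)) (VecP.map-cong (λ x → trans (+-assoc x c a) (cong (x +_) c+a)) τs)
    θ-reindexed : shift a (shift c θ) ≡ θ′
    θ-reindexed = trans (shift-shift a c θ) (cong (λ b → shift b θ) c+a)
    shift-G′ : ∀ w → shift a (G′ w) ≡ G (shift a w)
    shift-G′ w = begin
      shift a (G′ w)
        ≡⟨ graftWord-shift (i ∸ a) n a (vmap (_+ c) τs) (shift c θ) w (arity-positive t) ⟩
      graftWord (i ∸ a + a) n (vmap (_+ a) (vmap (_+ c) τs)) (shift a (shift c θ)) (shift a w)
        ≡⟨ cong (λ j → graftWord j n (vmap (_+ a) (vmap (_+ c) τs)) (shift a (shift c θ)) (shift a w))
                (m∸n+n≡m (<⇒≤ a<i)) ⟩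
      graftWord i n (vmap (_+ a) (vmap (_+ c) τs)) (shift a (shift c θ)) (shift a w)
        ≡⟨ cong₂ (λ σs ϑ → graftWord i n σs ϑ (shift a w)) τs-reindexed θ-reindexed ⟩
      G (shift a w) ∎

graftWord-occurrence : ∀ i n {m} τ (τs : Vec ℕ m) θ w Z → i ∉ w →
  graftWord i n (τ ∷ τs) θ (w ++ i ∷ Z) ≡ expand i n w ++ τ ∷ graftWord i n τs θ Z
graftWord-occurrence i n τ τs θ [] Z _ rewrite ≡ᵇ-refl i = refl
graftWord-occurrence i n τ τs θ (x ∷ w) Z i∉ rewrite ≡ᵇ-false (λ x≡i → i∉ (here (sym x≡i))) =
  cong (expandLetter i n x ∷_) (graftWord-occurrence i n τ τs θ w Z (i∉ ∘ there))

snoc-++-assoc : ∀ (w : Word) x U V → ((w ++ x ∷ []) ++ U) ++ V ≡ w ++ x ∷ U ++ V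
snoc-++-assoc w x U V = trans (++-assoc (w ++ x ∷ []) U V) (++-assoc w (x ∷ []) (U ++ V))

graftWord-factorization : ∀ i n c {m} (ws : Vec Word m) (τs : Vec ℕ m) θ μ ν →
  All (i ∉_) (toList ws) → All (_< i) μ → All (i <_) ν →
  graftWord i n (vmap (_+ c) τs) θ (concat (toList (vmap (λ w → w ++ i ∷ []) ws)) ++ μ ++ ν)
    ≡ concat (toList (zipWith (λ w τ → expand i n w ++ (τ + c) ∷ []) ws τs))
      ++ μ ++ θ ++ expand i n ν
graftWord-factorization i n c [] [] θ μ ν _ μ<i i<ν = begin
  graftWord i n [] θ (μ ++ ν)  ≡⟨ graftWord-++ʳ i n [] θ ν μ<i ⟩
  μ ++ splice i n θ ν          ≡⟨ cong (μ ++_) (splice-++ i n θ [] i<ν) ⟩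
  μ ++ θ ++ expand i n ν       ∎
graftWord-factorization i n c (w ∷ ws) (τ ∷ τs) θ μ ν (i∉w ∷ i∉ws) μ<i i<ν = begin
  graftWord i n σs θ (((w ++ i ∷ []) ++ W) ++ μ ++ ν)
    ≡⟨ cong (graftWord i n σs θ) (snoc-++-assoc w i W (μ ++ ν)) ⟩
  graftWord i n σs θ (w ++ i ∷ W ++ μ ++ ν)
    ≡⟨ graftWord-occurrence i n (τ + c) _ θ w _ i∉w ⟩
  expand i n w ++ (τ + c) ∷ graftWord i n (vmap (_+ c) τs) θ (W ++ μ ++ ν)
    ≡⟨ cong (λ z → expand i n w ++ (τ + c) ∷ z)
            (graftWord-factorization i n c ws τs θ μ ν i∉ws μ<i i<ν) ⟩
  expand i n w ++ (τ + c) ∷ E ++ μ ++ θ ++ expand i n ν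
    ≡⟨ sym (snoc-++-assoc (expand i n w) (τ + c) E _) ⟩
  ((expand i n w ++ (τ + c) ∷ []) ++ E) ++ μ ++ θ ++ expand i n ν ∎
  where
  σs : Vec ℕ _
  σs = vmap (_+ c) (τ ∷ τs)
  W E : Word
  W = concat (toList (vmap (λ w → w ++ i ∷ []) ws))
  E = concat (toList (zipWith (λ w τ → expand i n w ++ (τ + c) ∷ []) ws τs))

proposition5p58 : (k : ℕ) → 1 ≤ k → (s t : Tree k) → (i : ℕ) → 1 ≤ i → i ≤ arity s →
    (ws : Vec Word k) → (wk : Word) →
    All (λ w → i ∉ w) (toList ws) → i ∉ wk →
    TEval s ≡ concat (toList (vmap (λ w → w ++ i ∷ []) ws)) ++ wk →
    (∃₂ λ μ ν → wk ≡ μ ++ ν × All (λ x → x < i) μ × All (λ x → i < x) ν)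
    × ((μ ν : Word) → wk ≡ μ ++ ν → All (λ x → x < i) μ → All (λ x → i < x) ν →
       (τs : Vec ℕ k) → (θ : Word) → TEval t ≡ toList τs ++ θ →
       TEval (graft s i t)
         ≡ concat (toList (zipWith (λ w τj → expand i (arity t) w ++ (τj + (i ∸ 1)) ∷ []) ws τs))
           ++ μ ++ shift (i ∸ 1) θ ++ expand i (arity t) ν)
proposition5p58 (suc k) k≥1 s t i 1≤i i≤s ws wk i∉ws i∉wk s≡ =
  wk-splits (concat-∷ʳ i ws) , λ μ ν wk≡ μ<i i<ν τs θ t≡ → begin
    TEval (graft s i t)   ≡⟨ TEval-graft s t 1≤i i≤s τs θ t≡ ⟩
    G τs θ (TEval s)      ≡⟨ cong (G τs θ) (trans s≡ (cong (W ++_) wk≡)) ⟩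
    G τs θ (W ++ μ ++ ν)  ≡⟨ graftWord-factorization i (arity t) (i ∸ 1) ws τs _ μ ν
                                                      i∉ws μ<i i<ν ⟩
    _                     ∎
  where
  W : Word
  W = concat (toList (vmap (λ w → w ++ i ∷ []) ws))
  G : Vec ℕ (suc k) → Word → Word → Word
  G τs θ = graftWord i (arity t) (vmap (_+ (i ∸ 1)) τs) (shift (i ∸ 1) θ)
  wk-splits : (∃ λ C → W ≡ C ++ i ∷ []) → SplitsAt i wk
  wk-splits (C , W≡) = TidyAt-suffix C (subst (TidyAt i) s≡′ (TEval-tidy k≥1 s 1≤i i≤s)) i∉wk
    where
    s≡′ : TEval s ≡ C ++ i ∷ wk
    s≡′ = trans s≡ (trans (cong (_++ wk) W≡) (++-assoc C (i ∷ []) wk))
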